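{- (Completeness of the ability fragment of CL.) Every valid formula of $\Phi_{\mathsf{CL}_{AB}}$ is derivable in the axiomatic system $\mathsf{CL}_{AB}$ described in the context.
   Context: Fix a nonempty finite set $Ag$ of agents and a countable set $AP$ of atoms. A coalition is a subset of $Ag$. For a nonempty set $Ac$ of actions and coalition $A$, a joint action of $A$ is a function $A\to Ac$; $JA_A$ denotes the set of these. A concurrent game model is $M=(St,Ac,av,out,L)$: $St$ nonempty set of states; $Ac$ nonempty set of actions; $av(s,A)\subseteq JA_A$ nonempty for each $s,A$, with $av(s,A)=\{\bigcup_{a\in A}\sigma_a\mid\sigma_a\in av(s,\{a\})\}$ for $A\neq\emptyset$ and $av(s,\emptyset)=\{\emptyset\}$; $out(s,\sigma)$ for $\sigma\in JA_A$ is $\emptyset$ if $\sigma\notin av(s,A)$, a singleton if $A=Ag$ and $\sigma\in av(s,Ag)$, and $\bigcup\{out(s,\sigma')\mid\sigma'\in av(s,Ag),\sigma\subseteq\sigma'\}$ if $A\ne Ag$ and $\sigma\in av(s,A)$; $L:St\to\mathcal P(AP)$. Coalition Logic: $\phi::=p\mid\top\mid\neg\phi\mid\phi\wedge\phi\mid\langle A\rangle\phi$, booleans standard, $M,s\models\langle A\rangle\phi$ iff there is $\sigma_A\in av(s,A)$ with $M,t\models\phi$ for all $t\in out(s,\sigma_A)$. Valid = true at every pointed model $(M,s)$. $\Phi_{\mathsf{CL}_{AB}}$: $\phi::=\top\mid\bot\mid p\mid\neg p\mid(\phi\wedge\phi)\mid(\phi\vee\phi)\mid\langle A\rangle\phi$.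 System $\mathsf{CL}_{AB}$: axioms are the propositional tautologies in $\Phi_{\mathsf{CL}_{AB}}$; rules: R1: from $\phi_1,\dots,\phi_n$ infer $\psi$ where $(\phi_1\wedge\dots\wedge\phi_n)\to\psi$ is a propositional tautology; R2: from $\phi$ infer $\langle A\rangle\phi$; R3: from $\langle A\rangle(\phi_1\vee\phi_2)\vee\chi$ infer $\langle A\rangle\phi_1\vee\langle Ag\rangle\phi_2\vee\chi$. -}

module Defs where

open import Data.Nat using (ℕ; suc)
open import Data.Bool using (Bool; true; false; not; _∧_; _∨_)
open import Data.Fin using (Fin)
open import Data.Fin.Subset using (Subset; _∈_; ⊤)
open import Data.List using (List)
open import Data.List.Membership.Propositional renaming (_∈_ to _∈ₗ_)
open import Data.Product using (Σ; ∃; _×_)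
open import Relation.Binary.PropositionalEquality using (_≡_)
open import Relation.Nullary using (¬_)

Atom : Set
Atom = ℕ

-- Everything is parameterised by n; the set of agents is Ag = Fin (suc n)
-- (a nonempty finite set).  Coalitions are subsets of Ag.
module CL (n : ℕ) where

  Agent : Set
  Agent = Fin (suc n)

  Coalition : Set
  Coalition = Subset (suc n)

  Ag : Coalition
  Ag = ⊤

  -- Concurrent game models.
  -- av(s,{a}) is given as the predicate avail s a on Ac (a joint action of
  -- the singleton {a} is just an action); av(s,A) for A ≠ ∅ is the set of
  -- unions of singleton choices (JointAvail below), av(s,∅) = {∅}.
  -- out(s,σ) for σ ∈ av(s,Ag) is the singleton {outcome s σ}; for other
  -- coalitions it is the union over available full extensions (Out below).
  record Model : Set₁ where
    field
      St      : Set
      Ac      : Set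
      avail   : St → Agent → Ac → Set
      avail-ne : ∀ s a → ∃ (avail s a)
      outcome : St → (Agent → Ac) → St
      L       : St → Atom → Bool

  JA : Set → Coalition → Set
  JA Ac A = (i : Agent) → i ∈ A → Ac

  module _ (M : Model) where
    open Model M

    JointAvail : St → (A : Coalition) → JA Ac A → Set
    JointAvail s A σ = (i : Agent) (p : i ∈ A) → avail s i (σ i p)

    Out : St → (A : Coalition) → JA Ac A → St → Set
    Out s A σ t =
      JointAvail s A σ ×
      Σ (Agent → Ac) λ σ' →
        ((i : Agent) → avail s i (σ' i)) ×
        ((i : Agent) (p : i ∈ A) → σ' i ≡ σ i p) ×
        (outcome s σ' ≡ t)

  data Form : Set where
    atom : Atom → Form
    ⊤'   : Form
    ¬'_  : Form → Form
    _∧'_ : Form → Form → Form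
    ⟨_⟩_ : Coalition → Form → Form

  _⊨_ : {M : Model} → Model.St M → Form → Set
  _⊨_ {M} s (atom p) = Model.L M s p ≡ true
  _⊨_ {M} s ⊤' = Data.Unit.⊤ where import Data.Unit
  _⊨_ {M} s (¬' φ) = ¬ (_⊨_ {M} s φ)
  _⊨_ {M} s (φ ∧' ψ) = (_⊨_ {M} s φ) × (_⊨_ {M} s ψ)
  _⊨_ {M} s (⟨ A ⟩ φ) =
    Σ (JA (Model.Ac M) A) λ σ →
      JointAvail M s A σ ×
      ((t : Model.St M) → Out M s A σ t → _⊨_ {M} t φ)

  data FormAB : Set where
    ⊤ᵃ   : FormAB
    ⊥ᵃ   : FormAB
    pos  : Atom → FormAB
    neg  : Atom → FormAB
    _∧ᵃ_ : FormAB → FormAB → FormAB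
    _∨ᵃ_ : FormAB → FormAB → FormAB
    ⟨_⟩ᵃ_ : Coalition → FormAB → FormAB

  infixr 5 _∨ᵃ_

  embed : FormAB → Form
  embed ⊤ᵃ = ⊤'
  embed ⊥ᵃ = ¬' ⊤'
  embed (pos p) = atom p
  embed (neg p) = ¬' atom p
  embed (φ ∧ᵃ ψ) = embed φ ∧' embed ψ
  embed (φ ∨ᵃ ψ) = ¬' ((¬' embed φ) ∧' (¬' embed ψ))
  embed (⟨ A ⟩ᵃ φ) = ⟨ A ⟩ embed φ

  Valid : FormAB → Set₁
  Valid φ = (M : Model) (s : Model.St M) → _⊨_ {M} s (embed φ)

  -- Propositional evaluation: atoms and modal formulas ⟨A⟩φ are treated as
  -- propositional variables.
  evalP : (Atom → Bool) → (Coalition → FormAB → Bool) → FormAB → Bool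
  evalP v w ⊤ᵃ = true
  evalP v w ⊥ᵃ = false
  evalP v w (pos p) = v p
  evalP v w (neg p) = not (v p)
  evalP v w (φ ∧ᵃ ψ) = evalP v w φ ∧ evalP v w ψ
  evalP v w (φ ∨ᵃ ψ) = evalP v w φ ∨ evalP v w ψ
  evalP v w (⟨ A ⟩ᵃ φ) = w A φ

  Tautology : FormAB → Set
  Tautology φ = ∀ v w → evalP v w φ ≡ true

  TautEntails : List FormAB → FormAB → Set
  TautEntails φs ψ =
    ∀ v w → (∀ φ → φ ∈ₗ φs → evalP v w φ ≡ true) → evalP v w ψ ≡ true

  data ⊢_ : FormAB → Set where
    axiom : ∀ {φ} → Tautology φ → ⊢ φ
    R1 : ∀ (φs : List FormAB) {ψ} →
         (∀ φ → φ ∈ₗ φs → ⊢ φ) → TautEntails φs ψ → ⊢ ψ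
    R2 : ∀ {A φ} → ⊢ φ → ⊢ (⟨ A ⟩ᵃ φ)
    R3 : ∀ {A φ₁ φ₂ χ} → ⊢ ((⟨ A ⟩ᵃ (φ₁ ∨ᵃ φ₂)) ∨ᵃ χ) →
         ⊢ ((⟨ A ⟩ᵃ φ₁) ∨ᵃ ((⟨ Ag ⟩ᵃ φ₂) ∨ᵃ χ))

-- Every formula φ is decided: either ⊢ φ, or φ fails in one canonical model whose states
-- are finite trees labelled by valuations.  There every agent plays an integer and the
-- successor of a node is the child indexed by the sum of all actions, so an agent outside
-- a coalition can steer to any child.
--
-- The decision is by induction on modal depth.  Put φ in conjunctive normal form.  A
-- clause containing p and ¬p is a tautology.  Otherwise let G be the bodies of its
-- ⟨Ag⟩-literals and, for every literal ⟨A⟩ψ, decide ψ ∨ ⋁G.  If one of these is derivable,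
-- R2 gives ⟨A⟩(ψ ∨ ⋁G) and repeated R3 splits it into ⟨A⟩ψ ∨ ⋁{⟨Ag⟩g | g ∈ G}, a
-- subclause.  Otherwise the refuting trees become the children of a root falsifying the
-- atomic literals: no child satisfies any g ∈ G, which refutes the ⟨Ag⟩-literals, and for
-- A ≠ Ag an agent outside A steers to a child refuting ψ.
module Submission where

open import Level using (0ℓ)
open import Data.Nat using (ℕ; zero; suc; _<_; _⊔_; _≟_)
open import Data.Nat.Properties using (≤-refl; ⊔-lub; m<n⇒m<n⊔o; m<n⇒m<o⊔n)
open import Data.Nat.Induction using (<-wellFounded)
open import Data.Integer using (ℤ; +_; 0ℤ; _+_; _-_; -_; ∣_∣)
import Data.Integer.Properties as ℤ
open import Algebra.Properties.CommutativeMonoid.Sum ℤ.+-0-commutativeMonoid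
  using (sum; sum-remove; sum-cong-≗)
open import Data.Bool using (Bool; true; false; not; _∧_; _∨_)
open import Data.Bool.Properties
  using (∨-assoc; ∧-assoc; ∨-identityʳ; ∧-identityʳ; ∨-zeroʳ; ∨-distribˡ-∧; ∨-distribʳ-∧)
open import Data.Fin using (Fin; punchIn)
open import Data.Fin.Properties using (all?; ¬∀⟶∃¬; punchInᵢ≢i)
open import Data.Fin.Subset using (Subset; ⊤) renaming (_∈_ to _∈ₛ_; _∉_ to _∉ₛ_)
open import Data.Fin.Subset.Properties using (_∈?_; ∈⊤; ⊆⊤; ⊆-antisym)
import Data.Vec as Vec
open import Data.Vec.Functional using (updateAt; removeAt)
open import Data.Vec.Functional.Properties using (updateAt-updates; updateAt-minimal)
open import Data.List using (List; []; _∷_; [_]; _++_; map; cartesianProductWith)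
open import Data.Bool.ListAction using (all)
open import Data.List.Properties using (++-identityʳ)
open import Data.List.Relation.Unary.Any using (Any; here; there; any?)
open import Data.List.Relation.Unary.All as All using (All; []; _∷_)
open import Data.List.Membership.Propositional using (_∈_; find; lose)
open import Data.List.Membership.Propositional.Properties
  using (∈-map⁺; ∈-map⁻; ∈-++⁺ˡ; ∈-++⁺ʳ; ∈-++⁻; ∈-cartesianProductWith⁻)
open import Data.List.Relation.Binary.Subset.Propositional using (_⊆_)
open import Data.List.Relation.Binary.Subset.Propositional.Properties
  using (⊆-trans; ⊆-reflexive; ⊆-reflexive-↭; Any-resp-⊆; xs⊆x∷xs; ∷⁺ʳ; ∈-∷⁺ʳ)
open import Data.List.Relation.Binary.Permutation.Propositional using (↭-swap; ↭-refl)
open import Data.List.Relation.Binary.Permutation.Propositional.Properties using (shift)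
open import Data.Product using (∃; _×_; _,_; proj₁; proj₂)
import Data.Product as Product
open import Data.Sum using (_⊎_; inj₁; inj₂)
import Data.Sum as Sum
open import Data.Empty using (⊥)
open import Data.Unit using (tt) renaming (⊤ to Unit)
open import Function using (_∘_; id; const)
open import Induction.WellFounded as WF using ()
import Relation.Binary.Construct.On as On
open import Relation.Binary.PropositionalEquality
  using (_≡_; _≢_; _≗_; refl; sym; trans; cong; cong₂; subst; module ≡-Reasoning)
open import Relation.Nullary using (¬_; Dec; yes; no; does; contradiction)
open import Relation.Nullary.Decidable using (dec-true; dec-false; map′)
open import Relation.Unary using (Pred; Decidable)
open import Defs

∈ₛ-irrelevant : ∀ {m} {A : Subset m} {i} (p q : i ∈ₛ A) → p ≡ q
∈ₛ-irrelevant Vec.here Vec.here = refl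
∈ₛ-irrelevant (Vec.there p) (Vec.there q) = cong Vec.there (∈ₛ-irrelevant p q)

⊤-or-missing : ∀ {m} (A : Subset m) → A ≡ ⊤ ⊎ ∃ (_∉ₛ A)
⊤-or-missing A with all? (_∈? A)
... | yes all∈ = inj₁ (⊆-antisym ⊆⊤ (λ {i} _ → all∈ i))
... | no ¬all∈ = inj₂ (¬∀⟶∃¬ _ (_∈ₛ A) (_∈? A) ¬all∈)

module _ {m : ℕ} {A : Subset m} where

  Extends : (Fin m → ℤ) → ((i : Fin m) → i ∈ₛ A → ℤ) → Set
  Extends σ′ σ = ∀ i (p : i ∈ₛ A) → σ′ i ≡ σ i p

  extend : ((i : Fin m) → i ∈ₛ A → ℤ) → Fin m → ℤ
  extend σ i with i ∈? A
  ... | yes p = σ i p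
  ... | no _ = 0ℤ

  extend-extends : ∀ σ → Extends (extend σ) σ
  extend-extends σ i p with i ∈? A
  ... | yes p′ = cong (σ i) (∈ₛ-irrelevant p′ p)
  ... | no p∉ = contradiction p p∉

sum-updateAt : ∀ {m} (f : Fin (suc m) → ℤ) i x →
               sum (updateAt f i (const x)) ≡ x + sum (removeAt f i)
sum-updateAt f i x = begin
  sum f′                      ≡⟨ sum-remove {i = i} f′ ⟩
  f′ i + sum (removeAt f′ i)  ≡⟨ cong₂ _+_ (updateAt-updates i f) (sum-cong-≗ unchanged) ⟩
  x + sum (removeAt f i)      ∎
  where
  open ≡-Reasoning
  f′ = updateAt f i (const x)
  unchanged : removeAt f′ i ≗ removeAt f i
  unchanged j = updateAt-minimal (punchIn i j) i f (punchInᵢ≢i i j)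

steer : ∀ {m} {A : Subset (suc m)} {b} → b ∉ₛ A → ∀ σ z →
        ∃ λ σ′ → Extends {A = A} σ′ σ × sum σ′ ≡ z
steer {b = b} b∉A σ z = σ′ , σ′-extends , σ′-sum
  where
  open ≡-Reasoning
  rest = sum (removeAt (extend σ) b)
  σ′ = updateAt (extend σ) b (const (z - rest))
  σ′-extends : Extends σ′ σ
  σ′-extends i p = trans (updateAt-minimal i b _ λ { refl → b∉A p }) (extend-extends σ i p)
  σ′-sum : sum σ′ ≡ z
  σ′-sum = begin
    sum σ′               ≡⟨ sum-updateAt (extend σ) b (z - rest) ⟩
    (z - rest) + rest    ≡⟨ ℤ.+-assoc z (- rest) rest ⟩
    z + (- rest + rest)  ≡⟨ cong (_+_ z) (ℤ.+-inverseˡ rest) ⟩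
    z + 0ℤ               ≡⟨ ℤ.+-identityʳ z ⟩
    z                    ∎

all-++ : ∀ {a} {X : Set a} (p : X → Bool) xs ys → all p (xs ++ ys) ≡ all p xs ∧ all p ys
all-++ p [] ys = refl
all-++ p (x ∷ xs) ys = trans (cong (p x ∧_) (all-++ p xs ys)) (sym (∧-assoc (p x) _ _))

all-true : ∀ {a} {X : Set a} {p : X → Bool} xs → (∀ {x} → x ∈ xs → p x ≡ true) → all p xs ≡ true
all-true [] _ = refl
all-true (x ∷ xs) true-on rewrite true-on (here refl) = all-true xs (true-on ∘ there)

all⊎any : ∀ {a p q} {X : Set a} {P : Pred X p} {Q : Pred X q} xs →
          (∀ {x} → x ∈ xs → P x ⊎ Q x) → All P xs ⊎ Any Q xs
all⊎any [] _ = inj₁ []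
all⊎any (x ∷ xs) p⊎q with p⊎q (here refl)
... | inj₁ px = Sum.map (px ∷_) there (all⊎any xs (p⊎q ∘ there))
... | inj₂ qx = inj₂ (here qx)

nth⁺ : ∀ {a} {X : Set a} → X → List X → ℕ → X
nth⁺ x xs zero = x
nth⁺ x [] (suc k) = x
nth⁺ x (y ∷ ys) (suc k) = nth⁺ y ys k

nth⁺-∈ : ∀ {a} {X : Set a} (x : X) xs k → nth⁺ x xs k ∈ x ∷ xs
nth⁺-∈ x xs zero = here refl
nth⁺-∈ x [] (suc k) = here refl
nth⁺-∈ x (y ∷ ys) (suc k) = there (nth⁺-∈ y ys k)

nth⁺-onto : ∀ {a} {X : Set a} {x : X} {xs y} → y ∈ x ∷ xs → ∃ λ k → nth⁺ x xs k ≡ y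
nth⁺-onto (here refl) = zero , refl
nth⁺-onto {xs = _ ∷ _} (there y∈) = Product.map suc id (nth⁺-onto y∈)

data Tree : Set where
  node : (Atom → Bool) → List Tree → Tree

label : Tree → Atom → Bool
label (node L _) = L

successor : Tree → ℕ → Tree
successor (node L []) _ = node L []
successor (node L (t ∷ ts)) k = nth⁺ t ts k

successor-∈ : ∀ {L ts u} k → u ∈ ts → successor (node L ts) k ∈ ts
successor-∈ {ts = t ∷ ts} k _ = nth⁺-∈ t ts k

successor-onto : ∀ {L ts u} → u ∈ ts → ∃ λ k → successor (node L ts) k ≡ u
successor-onto {ts = _ ∷ _} = nth⁺-onto

module Completeness (n : ℕ) where
  open CL n

  data Literal : Set where
    posL negL : Atom → Literal
    boxL : Coalition → FormAB → Literal

  Clause : Set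
  Clause = List Literal

  ⌜_⌝ : Literal → FormAB
  ⌜ posL p ⌝ = pos p
  ⌜ negL p ⌝ = neg p
  ⌜ boxL A φ ⌝ = ⟨ A ⟩ᵃ φ

  ⋁ : Clause → FormAB
  ⋁ [] = ⊥ᵃ
  ⋁ (ℓ ∷ c) = ⌜ ℓ ⌝ ∨ᵃ ⋁ c

  infixr 5 _∨⁺_
  _∨⁺_ : FormAB → List FormAB → FormAB
  ψ ∨⁺ [] = ψ
  ψ ∨⁺ (g ∷ G) = ψ ∨ᵃ (g ∨⁺ G)

  cnf : FormAB → List Clause
  cnf ⊤ᵃ = []
  cnf ⊥ᵃ = [ [] ]
  cnf (pos p) = [ [ posL p ] ]
  cnf (neg p) = [ [ negL p ] ]
  cnf (φ ∧ᵃ ψ) = cnf φ ++ cnf ψ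
  cnf (φ ∨ᵃ ψ) = cartesianProductWith _++_ (cnf φ) (cnf ψ)
  cnf (⟨ A ⟩ᵃ φ) = [ [ boxL A φ ] ]

  module Evaluation (v : Atom → Bool) (w : Coalition → FormAB → Bool) where

    ⟦_⟧ : FormAB → Bool
    ⟦_⟧ = evalP v w

    ⟦_⟧ᶜ : Clause → Bool
    ⟦ c ⟧ᶜ = ⟦ ⋁ c ⟧

    ⟦⋁⟧-true⁺ : ∀ {c} → Any (λ ℓ → ⟦ ⌜ ℓ ⌝ ⟧ ≡ true) c → ⟦ c ⟧ᶜ ≡ true
    ⟦⋁⟧-true⁺ (here ℓ-true) rewrite ℓ-true = refl
    ⟦⋁⟧-true⁺ {ℓ ∷ _} (there c-true) rewrite ⟦⋁⟧-true⁺ c-true = ∨-zeroʳ ⟦ ⌜ ℓ ⌝ ⟧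

    ⟦⋁⟧-true⁻ : ∀ c → ⟦ c ⟧ᶜ ≡ true → Any (λ ℓ → ⟦ ⌜ ℓ ⌝ ⟧ ≡ true) c
    ⟦⋁⟧-true⁻ (ℓ ∷ c) c-true with ⟦ ⌜ ℓ ⌝ ⟧ in ℓ-value
    ... | true = here ℓ-value
    ... | false = there (⟦⋁⟧-true⁻ c c-true)

    ⟦⋁⟧-++ : ∀ c d → ⟦ c ++ d ⟧ᶜ ≡ ⟦ c ⟧ᶜ ∨ ⟦ d ⟧ᶜ
    ⟦⋁⟧-++ [] d = refl
    ⟦⋁⟧-++ (ℓ ∷ c) d =
      trans (cong (⟦ ⌜ ℓ ⌝ ⟧ ∨_) (⟦⋁⟧-++ c d)) (sym (∨-assoc ⟦ ⌜ ℓ ⌝ ⟧ ⟦ c ⟧ᶜ ⟦ d ⟧ᶜ))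

    all-prefix : ∀ c ds → all ⟦_⟧ᶜ (map (c ++_) ds) ≡ ⟦ c ⟧ᶜ ∨ all ⟦_⟧ᶜ ds
    all-prefix c [] = sym (∨-zeroʳ ⟦ c ⟧ᶜ)
    all-prefix c (d ∷ ds) = begin
      ⟦ c ++ d ⟧ᶜ ∧ all ⟦_⟧ᶜ (map (c ++_) ds)   ≡⟨ cong₂ _∧_ (⟦⋁⟧-++ c d) (all-prefix c ds) ⟩
      (⟦ c ⟧ᶜ ∨ ⟦ d ⟧ᶜ) ∧ (⟦ c ⟧ᶜ ∨ all ⟦_⟧ᶜ ds) ≡⟨ ∨-distribˡ-∧ ⟦ c ⟧ᶜ _ _ ⟨
      ⟦ c ⟧ᶜ ∨ (⟦ d ⟧ᶜ ∧ all ⟦_⟧ᶜ ds)            ∎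
      where open ≡-Reasoning

    all-cartesian : ∀ cs ds → all ⟦_⟧ᶜ (cartesianProductWith _++_ cs ds) ≡ all ⟦_⟧ᶜ cs ∨ all ⟦_⟧ᶜ ds
    all-cartesian [] ds = refl
    all-cartesian (c ∷ cs) ds = begin
      all ⟦_⟧ᶜ (map (c ++_) ds ++ cartesianProductWith _++_ cs ds)
        ≡⟨ all-++ ⟦_⟧ᶜ (map (c ++_) ds) _ ⟩
      all ⟦_⟧ᶜ (map (c ++_) ds) ∧ all ⟦_⟧ᶜ (cartesianProductWith _++_ cs ds)
        ≡⟨ cong₂ _∧_ (all-prefix c ds) (all-cartesian cs ds) ⟩
      (⟦ c ⟧ᶜ ∨ all ⟦_⟧ᶜ ds) ∧ (all ⟦_⟧ᶜ cs ∨ all ⟦_⟧ᶜ ds)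
        ≡⟨ ∨-distribʳ-∧ (all ⟦_⟧ᶜ ds) ⟦ c ⟧ᶜ _ ⟨
      (⟦ c ⟧ᶜ ∧ all ⟦_⟧ᶜ cs) ∨ all ⟦_⟧ᶜ ds
        ∎
      where open ≡-Reasoning

    ⟦literal⟧ : ∀ ℓ → ⟦ ⌜ ℓ ⌝ ⟧ ≡ all ⟦_⟧ᶜ [ [ ℓ ] ]
    ⟦literal⟧ ℓ = sym (trans (∧-identityʳ _) (∨-identityʳ _))

    ⟦cnf⟧ : ∀ φ → ⟦ φ ⟧ ≡ all ⟦_⟧ᶜ (cnf φ)
    ⟦cnf⟧ ⊤ᵃ = refl
    ⟦cnf⟧ ⊥ᵃ = refl
    ⟦cnf⟧ (pos p) = ⟦literal⟧ (posL p)
    ⟦cnf⟧ (neg p) = ⟦literal⟧ (negL p)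
    ⟦cnf⟧ (φ ∧ᵃ ψ) = trans (cong₂ _∧_ (⟦cnf⟧ φ) (⟦cnf⟧ ψ)) (sym (all-++ ⟦_⟧ᶜ (cnf φ) (cnf ψ)))
    ⟦cnf⟧ (φ ∨ᵃ ψ) = trans (cong₂ _∨_ (⟦cnf⟧ φ) (⟦cnf⟧ ψ)) (sym (all-cartesian (cnf φ) (cnf ψ)))
    ⟦cnf⟧ (⟨ A ⟩ᵃ φ) = ⟦literal⟧ (boxL A φ)

  open Evaluation using (⟦⋁⟧-true⁺; ⟦⋁⟧-true⁻; ⟦cnf⟧)

  ⊢-mono : ∀ {φ ψ} → ⊢ φ → (∀ v w → evalP v w φ ≡ true → evalP v w ψ ≡ true) → ⊢ ψ
  ⊢-mono {φ} ⊢φ φ⇒ψ = R1 [ φ ] (λ { _ (here refl) → ⊢φ }) (λ v w h → φ⇒ψ v w (h φ (here refl)))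

  ⊢-⋁-mono : ∀ {c d} → c ⊆ d → ⊢ ⋁ c → ⊢ ⋁ d
  ⊢-⋁-mono {c} c⊆d ⊢c = ⊢-mono ⊢c λ v w c-true →
    ⟦⋁⟧-true⁺ v w (Any-resp-⊆ c⊆d (⟦⋁⟧-true⁻ v w c c-true))

  ⊢-cnf : ∀ φ → All (λ c → ⊢ ⋁ c) (cnf φ) → ⊢ φ
  ⊢-cnf φ ⊢clauses = R1 (map ⋁ (cnf φ)) ⊢premise entails
    where
    ⊢premise : ∀ χ → χ ∈ map ⋁ (cnf φ) → ⊢ χ
    ⊢premise χ χ∈ with c , c∈ , refl ← ∈-map⁻ ⋁ χ∈ = All.lookup ⊢clauses c∈
    entails : TautEntails (map ⋁ (cnf φ)) φ
    entails v w premises-true =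
      trans (⟦cnf⟧ v w φ) (all-true (cnf φ) (λ c∈ → premises-true _ (∈-map⁺ ⋁ c∈)))

  R3⋆ : ∀ A ψ G c → ⊢ ⋁ (boxL A (ψ ∨⁺ G) ∷ c) → ⊢ ⋁ (boxL A ψ ∷ map (boxL Ag) G ++ c)
  R3⋆ A ψ [] c ⊢c = ⊢c
  R3⋆ A ψ (g ∷ G) c ⊢c =
    ⊢-⋁-mono (⊆-reflexive-↭ (shift (boxL A ψ) (boxL Ag g ∷ map (boxL Ag) G) c))
      (R3⋆ Ag g G (boxL A ψ ∷ c) (⊢-⋁-mono (⊆-reflexive-↭ (↭-swap _ _ ↭-refl)) (R3 ⊢c)))

  ⊢-⋁-from-box : ∀ {A ψ G c} → boxL A ψ ∈ c → map (boxL Ag) G ⊆ c → ⊢ (ψ ∨⁺ G) → ⊢ ⋁ c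
  ⊢-⋁-from-box {A} {ψ} {G} {c} box∈c G⊆c ⊢ψ∨G = ⊢-⋁-mono included (R3⋆ A ψ G [] ⊢⟨A⟩ψ∨G)
    where
    ⊢⟨A⟩ψ∨G : ⊢ ⋁ [ boxL A (ψ ∨⁺ G) ]
    ⊢⟨A⟩ψ∨G = ⊢-mono (R2 ⊢ψ∨G) (λ v w h → trans (∨-identityʳ _) h)
    included : boxL A ψ ∷ map (boxL Ag) G ++ [] ⊆ c
    included = ∈-∷⁺ʳ box∈c (⊆-trans (⊆-reflexive (++-identityʳ _)) G⊆c)

  depth : FormAB → ℕ
  depth ⊤ᵃ = 0
  depth ⊥ᵃ = 0
  depth (pos _) = 0
  depth (neg _) = 0
  depth (φ ∧ᵃ ψ) = depth φ ⊔ depth ψ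
  depth (φ ∨ᵃ ψ) = depth φ ⊔ depth ψ
  depth (⟨ _ ⟩ᵃ φ) = suc (depth φ)

  depth-cnf : ∀ φ {c A ψ} → c ∈ cnf φ → boxL A ψ ∈ c → depth ψ < depth φ
  depth-cnf ⊥ᵃ (here refl) ()
  depth-cnf (pos _) (here refl) (here ())
  depth-cnf (neg _) (here refl) (here ())
  depth-cnf (⟨ _ ⟩ᵃ _) (here refl) (here refl) = ≤-refl
  depth-cnf (φ ∧ᵃ ψ) c∈ box∈ with ∈-++⁻ (cnf φ) c∈
  ... | inj₁ c∈φ = m<n⇒m<n⊔o (depth ψ) (depth-cnf φ c∈φ box∈)
  ... | inj₂ c∈ψ = m<n⇒m<o⊔n (depth φ) (depth-cnf ψ c∈ψ box∈)
  depth-cnf (φ ∨ᵃ ψ) c∈ box∈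
    with c₁ , c₂ , c₁∈ , c₂∈ , refl ← ∈-cartesianProductWith⁻ _++_ (cnf φ) (cnf ψ) c∈
    with ∈-++⁻ c₁ box∈
  ... | inj₁ box∈c₁ = m<n⇒m<n⊔o (depth ψ) (depth-cnf φ c₁∈ box∈c₁)
  ... | inj₂ box∈c₂ = m<n⇒m<o⊔n (depth φ) (depth-cnf ψ c₂∈ box∈c₂)

  depth-∨⁺ : ∀ {d} ψ G → depth ψ < d → (∀ {g} → g ∈ G → depth g < d) → depth (ψ ∨⁺ G) < d
  depth-∨⁺ ψ [] ψ< _ = ψ<
  depth-∨⁺ ψ (g ∷ G) ψ< G< = ⊔-lub ψ< (depth-∨⁺ g G (G< (here refl)) (G< ∘ there))

  agBodies : Clause → List FormAB
  agBodies [] = []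
  agBodies (posL _ ∷ c) = agBodies c
  agBodies (negL _ ∷ c) = agBodies c
  agBodies (boxL A ψ ∷ c) with ⊤-or-missing A
  ... | inj₁ _ = ψ ∷ agBodies c
  ... | inj₂ _ = agBodies c

  agBoxes-⊆ : ∀ c → map (boxL Ag) (agBodies c) ⊆ c
  agBoxes-⊆ [] = λ ()
  agBoxes-⊆ (posL _ ∷ c) = ⊆-trans (agBoxes-⊆ c) (xs⊆x∷xs c _)
  agBoxes-⊆ (negL _ ∷ c) = ⊆-trans (agBoxes-⊆ c) (xs⊆x∷xs c _)
  agBoxes-⊆ (boxL A ψ ∷ c) with ⊤-or-missing A
  ... | inj₁ refl = ∷⁺ʳ _ (agBoxes-⊆ c)
  ... | inj₂ _ = ⊆-trans (agBoxes-⊆ c) (xs⊆x∷xs c _)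

  ∈-agBodies : ∀ {ψ} c → boxL Ag ψ ∈ c → ψ ∈ agBodies c
  ∈-agBodies (_ ∷ c) (here refl) with ⊤-or-missing Ag
  ... | inj₁ _ = here refl
  ... | inj₂ (_ , ∉Ag) = contradiction ∈⊤ ∉Ag
  ∈-agBodies (posL _ ∷ c) (there box∈) = ∈-agBodies c box∈
  ∈-agBodies (negL _ ∷ c) (there box∈) = ∈-agBodies c box∈
  ∈-agBodies (boxL A _ ∷ c) (there box∈) with ⊤-or-missing A
  ... | inj₁ _ = there (∈-agBodies c box∈)
  ... | inj₂ _ = ∈-agBodies c box∈

  canonical : Model
  canonical = record
    { St = Tree
    ; Ac = ℤ
    ; avail = λ _ _ _ → Unit
    ; avail-ne = λ _ _ → 0ℤ , tt
    ; outcome = λ t σ → successor t ∣ sum σ ∣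
    ; L = label
    }

  infix 4 _⊭_ _⊭ᶜ_

  _⊭_ : Tree → FormAB → Set
  t ⊭ φ = ¬ (_⊨_ {canonical} t (embed φ))

  _⊭ᶜ_ : Tree → Clause → Set
  t ⊭ᶜ c = ∀ {ℓ} → ℓ ∈ c → t ⊭ ⌜ ℓ ⌝

  Decided : FormAB → Set
  Decided φ = ⊢ φ ⊎ ∃ (_⊭ φ)

  ⊭-∨ : ∀ {t φ ψ} → t ⊭ φ → t ⊭ ψ → t ⊭ φ ∨ᵃ ψ
  ⊭-∨ t⊭φ t⊭ψ both-fail = both-fail (t⊭φ , t⊭ψ)

  ⊭-∨⁻ : ∀ {t φ ψ} → t ⊭ φ ∨ᵃ ψ → t ⊭ φ × t ⊭ ψ
  ⊭-∨⁻ t⊭φ∨ψ = (λ t⊨φ → t⊭φ∨ψ (λ fails → proj₁ fails t⊨φ))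
             , (λ t⊨ψ → t⊭φ∨ψ (λ fails → proj₂ fails t⊨ψ))

  ⊭-∨⁺ : ∀ {t} ψ G → t ⊭ ψ ∨⁺ G → t ⊭ ψ × (∀ {g} → g ∈ G → t ⊭ g)
  ⊭-∨⁺ ψ [] t⊭ψ = t⊭ψ , λ ()
  ⊭-∨⁺ ψ (g ∷ G) t⊭ψ∨G with t⊭ψ , t⊭g∨G ← ⊭-∨⁻ t⊭ψ∨G with t⊭g , t⊭G ← ⊭-∨⁺ g G t⊭g∨G =
    t⊭ψ , λ { (here refl) → t⊭g ; (there g∈) → t⊭G g∈ }

  ⊭-cnf : ∀ φ {c t} → c ∈ cnf φ → t ⊭ᶜ c → t ⊭ φ
  ⊭-cnf ⊥ᵃ (here refl) _ ⊨⊥ = ⊨⊥ tt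
  ⊭-cnf (pos _) (here refl) t⊭c = t⊭c (here refl)
  ⊭-cnf (neg _) (here refl) t⊭c = t⊭c (here refl)
  ⊭-cnf (⟨ _ ⟩ᵃ _) (here refl) t⊭c = t⊭c (here refl)
  ⊭-cnf (φ ∧ᵃ ψ) c∈ t⊭c with ∈-++⁻ (cnf φ) c∈
  ... | inj₁ c∈φ = λ t⊨φ∧ψ → ⊭-cnf φ c∈φ t⊭c (proj₁ t⊨φ∧ψ)
  ... | inj₂ c∈ψ = λ t⊨φ∧ψ → ⊭-cnf ψ c∈ψ t⊭c (proj₂ t⊨φ∧ψ)
  ⊭-cnf (φ ∨ᵃ ψ) c∈ t⊭c
    with c₁ , c₂ , c₁∈ , c₂∈ , refl ← ∈-cartesianProductWith⁻ _++_ (cnf φ) (cnf ψ) c∈ =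
    ⊭-∨ (⊭-cnf φ c₁∈ (t⊭c ∘ ∈-++⁺ˡ)) (⊭-cnf ψ c₂∈ (t⊭c ∘ ∈-++⁺ʳ c₁))

  ⊭-⟨⟩ : ∀ {t A ψ} → (∀ σ → ∃ λ σ′ → Extends {A = A} σ′ σ × successor t ∣ sum σ′ ∣ ⊭ ψ) →
         t ⊭ ⟨ A ⟩ᵃ ψ
  ⊭-⟨⟩ escape (σ , _ , forced) with σ′ , σ′-extends , σ′⊭ψ ← escape σ =
    σ′⊭ψ (forced _ ((λ _ _ → tt) , σ′ , (λ _ → tt) , σ′-extends , refl))

  record Successors (G : List FormAB) (c : Clause) : Set where
    field
      trees : List Tree
      trees-⊭ : ∀ {t g} → t ∈ trees → g ∈ G → t ⊭ g
      box-witness : ∀ {A ψ} → boxL A ψ ∈ c → ∃ λ t → t ∈ trees × t ⊭ ψ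

  open Successors

  Successors-skip : ∀ {G c ℓ} → (∀ {A ψ} → boxL A ψ ≢ ℓ) → Successors G c → Successors G (ℓ ∷ c)
  Successors-skip not-box S = record
    { trees = trees S
    ; trees-⊭ = trees-⊭ S
    ; box-witness = λ { (here eq) → contradiction eq not-box ; (there box∈) → box-witness S box∈ }
    }

  Successors-∷ : ∀ {G c A ψ u} → u ⊭ ψ ∨⁺ G → Successors G c → Successors G (boxL A ψ ∷ c)
  Successors-∷ {G} {ψ = ψ} {u} u⊭ψ∨G S with u⊭ψ , u⊭G ← ⊭-∨⁺ ψ G u⊭ψ∨G = record
    { trees = u ∷ trees S
    ; trees-⊭ = λ { (here refl) → u⊭G ; (there t∈) → trees-⊭ S t∈ }
    ; box-witness = λ { (here refl) → u , here refl , u⊭ψ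
                      ; (there box∈) → Product.map₂ (Product.map₁ there) (box-witness S box∈) }
    }

  gather : ∀ {X : Set} G c → (∀ {A ψ} → boxL A ψ ∈ c → X ⊎ ∃ (_⊭ ψ ∨⁺ G)) →
           X ⊎ Successors G c
  gather G [] _ = inj₂ record { trees = [] ; trees-⊭ = λ () ; box-witness = λ () }
  gather G (posL _ ∷ c) ask = Sum.map₂ (Successors-skip λ ()) (gather G c (ask ∘ there))
  gather G (negL _ ∷ c) ask = Sum.map₂ (Successors-skip λ ()) (gather G c (ask ∘ there))
  gather G (boxL A ψ ∷ c) ask with ask (here refl)
  ... | inj₁ x = inj₁ x
  ... | inj₂ (_ , u⊭ψ∨G) = Sum.map₂ (Successors-∷ u⊭ψ∨G) (gather G c (ask ∘ there))

  negL≟ : ∀ p ℓ → Dec (negL p ≡ ℓ)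
  negL≟ p (negL q) = map′ (cong negL) (λ { refl → refl }) (p ≟ q)
  negL≟ p (posL _) = no λ ()
  negL≟ p (boxL _ _) = no λ ()

  _negL∈?_ : ∀ p c → Dec (negL p ∈ c)
  p negL∈? c = any? (negL≟ p) c

  Clash : Clause → Literal → Set
  Clash c (posL p) = negL p ∈ c
  Clash c _ = ⊥

  clash? : ∀ c → Decidable (Clash c)
  clash? c (posL p) = p negL∈? c
  clash? c (negL _) = no id
  clash? c (boxL _ _) = no id

  complementary-tautology : ∀ {p c} → posL p ∈ c → negL p ∈ c → Tautology (⋁ c)
  complementary-tautology {p} pos∈ neg∈ v w with v p in vp
  ... | true = ⟦⋁⟧-true⁺ v w (lose pos∈ vp)
  ... | false = ⟦⋁⟧-true⁺ v w (lose neg∈ (cong not vp))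

  clash-tautology : ∀ {c} → Any (Clash c) c → Tautology (⋁ c)
  clash-tautology clash with find clash
  ... | posL _ , pos∈ , neg∈ = complementary-tautology pos∈ neg∈
  ... | negL _ , _ , ()
  ... | boxL _ _ , _ , ()

  module _ {c : Clause} (S : Successors (agBodies c) c) (consistent : ¬ Any (Clash c) c) where

    root : Tree
    root = node (λ p → does (p negL∈? c)) (trees S)

    root-⊭ : root ⊭ᶜ c
    root-⊭ {posL p} pos∈ rewrite dec-false (p negL∈? c) (consistent ∘ lose pos∈) = λ ()
    root-⊭ {negL p} neg∈ root⊨¬p = root⊨¬p (dec-true (p negL∈? c) neg∈)
    root-⊭ {boxL A ψ} box∈ with ⊤-or-missing A | box-witness S box∈
    ... | inj₁ refl | _ , u∈ , _ = ⊭-⟨⟩ {root} λ σ →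
      extend σ , extend-extends σ , trees-⊭ S (successor-∈ _ u∈) (∈-agBodies c box∈)
    ... | inj₂ (b , b∉A) | u , u∈ , u⊭ψ with k , hit ← successor-onto u∈ = ⊭-⟨⟩ {root} λ σ →
      let σ′ , σ′-extends , σ′-sum = steer b∉A σ (+ k)
      in σ′ , σ′-extends , subst (_⊭ ψ) (sym (trans (cong (successor root ∘ ∣_∣) σ′-sum) hit)) u⊭ψ

  decide-clause : ∀ c → (∀ {A ψ} → boxL A ψ ∈ c → Decided (ψ ∨⁺ agBodies c)) →
                  ⊢ ⋁ c ⊎ ∃ (_⊭ᶜ c)
  decide-clause c decide-box with any? (clash? c) c
  ... | yes clash = inj₁ (axiom (clash-tautology clash))
  ... | no consistent = Sum.map₂ (λ S → root S consistent , root-⊭ S consistent)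
    (gather (agBodies c) c λ box∈ → Sum.map₁ (⊢-⋁-from-box box∈ (agBoxes-⊆ c)) (decide-box box∈))

  decide : ∀ φ → Decided φ
  decide = WF.All.wfRec (On.wellFounded depth <-wellFounded) 0ℓ Decided decide-below
    where
    decide-below : ∀ φ → (∀ {ψ} → depth ψ < depth φ → Decided ψ) → Decided φ
    decide-below φ decide< with all⊎any (cnf φ) (λ {c} c∈ → decide-clause c (decide< ∘ bound c∈))
      where
      bound : ∀ {c A ψ} → c ∈ cnf φ → boxL A ψ ∈ c → depth (ψ ∨⁺ agBodies c) < depth φ
      bound {c} c∈ box∈ = depth-∨⁺ _ (agBodies c) (depth-cnf φ c∈ box∈)
        (λ g∈ → depth-cnf φ c∈ (agBoxes-⊆ c (∈-map⁺ (boxL Ag) g∈)))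
    ... | inj₁ ⊢clauses = inj₁ (⊢-cnf φ ⊢clauses)
    ... | inj₂ refuted with _ , c∈ , t , t⊭c ← find refuted = inj₂ (t , ⊭-cnf φ c∈ t⊭c)

mainTheorem9 : (n : ℕ) (φ : CL.FormAB n) → CL.Valid n φ → CL.⊢_ n φ
mainTheorem9 n φ valid with Completeness.decide n φ
... | inj₁ ⊢φ = ⊢φ
... | inj₂ (t , t⊭φ) = contradiction (valid (Completeness.canonical n) t) t⊭φ
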